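{- For each closed term $P\in\mathcal{SP}^{\mathsf U}_A$ that contains $\mathsf U$, there exists a string $\sigma\in A^*$ such that $\mathrm{EqFFEL}^{\mathsf U}\vdash P=\mathsf U_\sigma$.
   Context: $A$ is a countable set of atoms. $\mathcal{SP}^{\mathsf U}_A$: closed terms generated by $P::=\mathsf T\mid\mathsf F\mid\mathsf U\mid a\mid \neg P\mid P\mathbin{\wedge_\bullet}P\mid P\mathbin{\vee_\bullet}P$ ($a\in A$). For $\sigma\in A^*$ (finite strings over $A$, repetitions allowed): $\mathsf U_\epsilon=\mathsf U$ and $\mathsf U_{a\rho}=a\mathbin{\wedge_\bullet}\mathsf U_\rho$. $\mathrm{EqFFEL}^{\mathsf U}$ consists of: $\mathsf F=\neg\mathsf T$; $x\mathbin{\vee_\bullet}y=\neg(\neg x\mathbin{\wedge_\bullet}\neg y)$; $\neg\neg x=x$; $(x\mathbin{\wedge_\bullet}y)\mathbin{\wedge_\bullet}z=x\mathbin{\wedge_\bullet}(y\mathbin{\wedge_\bullet}z)$; $\mathsf T\mathbin{\wedge_\bullet}x=x$; $x\mathbin{\wedge_\bullet}\mathsf T=x$; $x\mathbin{\wedge_\bullet}\mathsf F=\mathsf F\mathbin{\wedge_\bullet}x$; $\neg x\mathbin{\wedge_\bullet}\mathsf F=x\mathbin{\wedge_\bullet}\mathsf F$; $(x\mathbin{\wedge_\bullet}\mathsf F)\mathbin{\vee_\bullet}y=(x\mathbin{\vee_\bullet}\mathsf T)\mathbin{\wedge_\bullet}y$; $x\mathbin{\vee_\bullet}(y\mathbin{\wedge_\bullet}\mathsf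 F)=x\mathbin{\wedge_\bullet}(y\mathbin{\vee_\bullet}\mathsf T)$; $\neg\mathsf U=\mathsf U$; $\mathsf U\mathbin{\wedge_\bullet}x=\mathsf U$. $\vdash$ is derivability in equational logic. -}

module Defs where

open import Data.Nat using (ℕ)
open import Data.List using (List; []; _∷_)
open import Data.Empty using (⊥)
open import Function using (Injective)
open import Relation.Binary.PropositionalEquality using (_≡_)

record Countable (A : Set) : Set where
  field
    enc : A → ℕ
    enc-inj : Injective _≡_ _≡_ enc

data Term (A : Set) (V : Set) : Set where
  T F U : Term A V
  atom : A → Term A V
  var  : V → Term A V
  ¬'_  : Term A V → Term A V
  _∧•_ : Term A V → Term A V → Term A V
  _∨•_ : Term A V → Term A V → Term A V

infix  9 ¬'_
infixr 7 _∧•_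
infixr 6 _∨•_

Closed : Set → Set
Closed A = Term A ⊥

_[_] : {A V W : Set} → Term A V → (V → Term A W) → Term A W
T [ s ] = T
F [ s ] = F
U [ s ] = U
atom a [ s ] = atom a
var v [ s ] = s v
(¬' p) [ s ] = ¬' (p [ s ])
(p ∧• q) [ s ] = (p [ s ]) ∧• (q [ s ])
(p ∨• q) [ s ] = (p [ s ]) ∨• (q [ s ])

data Var3 : Set where
  x y z : Var3

data Axiom (A : Set) : Term A Var3 → Term A Var3 → Set where
  ax-F     : Axiom A F (¬' T)
  ax-or    : Axiom A (var x ∨• var y) (¬' (¬' var x ∧• ¬' var y))
  ax-nn    : Axiom A (¬' ¬' var x) (var x)
  ax-assoc : Axiom A ((var x ∧• var y) ∧• var z) (var x ∧• (var y ∧• var z))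
  ax-Tl    : Axiom A (T ∧• var x) (var x)
  ax-Tr    : Axiom A (var x ∧• T) (var x)
  ax-F1    : Axiom A (var x ∧• F) (F ∧• var x)
  ax-F2    : Axiom A (¬' var x ∧• F) (var x ∧• F)
  ax-F3    : Axiom A ((var x ∧• F) ∨• var y) ((var x ∨• T) ∧• var y)
  ax-F4    : Axiom A (var x ∨• (var y ∧• F)) (var x ∧• (var y ∨• T))
  ax-U1    : Axiom A (¬' U) U
  ax-U2    : Axiom A (U ∧• var x) U

infix 4 _⊢_≈_
data _⊢_≈_ (A : Set) {V : Set} : Term A V → Term A V → Set where
  inst  : ∀ {l r} → Axiom A l r → (s : Var3 → Term A V) → A ⊢ (l [ s ]) ≈ (r [ s ])
  refl' : ∀ {p} → A ⊢ p ≈ p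
  sym'  : ∀ {p q} → A ⊢ p ≈ q → A ⊢ q ≈ p
  trans' : ∀ {p q r} → A ⊢ p ≈ q → A ⊢ q ≈ r → A ⊢ p ≈ r
  cong¬ : ∀ {p q} → A ⊢ p ≈ q → A ⊢ ¬' p ≈ ¬' q
  cong∧ : ∀ {p p' q q'} → A ⊢ p ≈ p' → A ⊢ q ≈ q' → A ⊢ (p ∧• q) ≈ (p' ∧• q')
  cong∨ : ∀ {p p' q q'} → A ⊢ p ≈ p' → A ⊢ q ≈ q' → A ⊢ (p ∨• q) ≈ (p' ∨• q')

data ContainsU {A V : Set} : Term A V → Set where
  here : ContainsU U
  in¬  : ∀ {p} → ContainsU p → ContainsU (¬' p)
  in∧l : ∀ {p q} → ContainsU p → ContainsU (p ∧• q)
  in∧r : ∀ {p q} → ContainsU q → ContainsU (p ∧• q)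
  in∨l : ∀ {p q} → ContainsU p → ContainsU (p ∨• q)
  in∨r : ∀ {p q} → ContainsU q → ContainsU (p ∨• q)

Uσ : {A V : Set} → List A → Term A V
Uσ [] = U
Uσ (a ∷ ρ) = atom a ∧• Uσ ρ

-- U_σ swallows everything to its right (U_σ ∧ q = U_σ), is a fixed point of ¬, and
-- absorbs F (U_σ = U_σ ∧ F). In front of such a term, ¬p ∧ W = p ∧ W and p ∨ W = p ∧ W,
-- so a closed term p in front of U_σ can be eaten atom by atom: p ∧ U_σ = U_τ for some τ
-- (an atom a turns U_σ into U_{aσ}, T and F vanish, U resets to U). Induction on the position of U in P then reduces
-- every term containing U to such a conjunction, to ¬U_σ, to U_σ ∧ q or to U_σ ∨ q.
module Submission where

open import Defs
open import Data.Empty using (⊥)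
open import Level using (0ℓ)
open import Data.List using (List; []; _∷_)
open import Data.Product using (∃; _,_; map₂)
open import Relation.Binary.Bundles using (Setoid)
import Relation.Binary.Reasoning.Setoid as SetoidReasoning

⊢-setoid : (A V : Set) → Setoid 0ℓ 0ℓ
⊢-setoid A V = record
  { Carrier       = Term A V
  ; _≈_           = A ⊢_≈_
  ; isEquivalence = record { refl = refl' ; sym = sym' ; trans = trans' }
  }

IsUσ : {A V : Set} → Term A V → Set
IsUσ {A} P = ∃ λ (σ : List A) → A ⊢ P ≈ Uσ σ

module _ {A V : Set} where
  open SetoidReasoning (⊢-setoid A V)

  sub₃ : Term A V → Term A V → Term A V → Var3 → Term A V
  sub₃ p q r x = p
  sub₃ p q r y = q
  sub₃ p q r z = r

  axiom : ∀ {l r} → Axiom A l r → (p q r' : Term A V) →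
          A ⊢ l [ sub₃ p q r' ] ≈ r [ sub₃ p q r' ]
  axiom a p q r' = inst a (sub₃ p q r')

  ¬T≈F : A ⊢ ¬' T ≈ F
  ¬T≈F = sym' (axiom ax-F T T T)

  ∧-assoc : (p q r : Term A V) → A ⊢ (p ∧• q) ∧• r ≈ p ∧• (q ∧• r)
  ∧-assoc = axiom ax-assoc

  ∧-congˡ : ∀ {p p' q : Term A V} → A ⊢ p ≈ p' → A ⊢ p ∧• q ≈ p' ∧• q
  ∧-congˡ e = cong∧ e refl'

  ∧-congʳ : ∀ {p q q' : Term A V} → A ⊢ q ≈ q' → A ⊢ p ∧• q ≈ p ∧• q'
  ∧-congʳ = cong∧ refl'

  ¬p∧W≈p∧W : ∀ {W} (p : Term A V) → A ⊢ W ≈ W ∧• F → A ⊢ ¬' p ∧• W ≈ p ∧• W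
  ¬p∧W≈p∧W {W} p W≈W∧F = begin
    ¬' p ∧• W         ≈⟨ ∧-congʳ W≈F∧W ⟩
    ¬' p ∧• (F ∧• W)  ≈⟨ ∧-assoc _ _ _ ⟨
    (¬' p ∧• F) ∧• W  ≈⟨ ∧-congˡ (axiom ax-F2 p T T) ⟩
    (p ∧• F) ∧• W     ≈⟨ ∧-assoc _ _ _ ⟩
    p ∧• (F ∧• W)     ≈⟨ ∧-congʳ W≈F∧W ⟨
    p ∧• W            ∎
    where
    W≈F∧W : A ⊢ W ≈ F ∧• W
    W≈F∧W = trans' W≈W∧F (axiom ax-F1 W T T)

  p∨W≈p∧W : ∀ {W} (p : Term A V) → A ⊢ W ≈ W ∧• F → A ⊢ ¬' W ≈ W → A ⊢ p ∨• W ≈ p ∧• W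
  p∨W≈p∧W {W} p W≈W∧F ¬W≈W = begin
    p ∨• W                  ≈⟨ cong∨ refl' W≈W∧F ⟩
    p ∨• (W ∧• F)           ≈⟨ axiom ax-F4 p W T ⟩
    p ∧• (W ∨• T)           ≈⟨ ∧-congʳ (axiom ax-or W T T) ⟩
    p ∧• ¬' (¬' W ∧• ¬' T)  ≈⟨ ∧-congʳ (cong¬ (cong∧ ¬W≈W ¬T≈F)) ⟩
    p ∧• ¬' (W ∧• F)        ≈⟨ ∧-congʳ (cong¬ W≈W∧F) ⟨
    p ∧• ¬' W               ≈⟨ ∧-congʳ ¬W≈W ⟩
    p ∧• W                  ∎

  Uσ∧p≈Uσ : ∀ σ (p : Term A V) → A ⊢ Uσ σ ∧• p ≈ Uσ σ
  Uσ∧p≈Uσ []      p = axiom ax-U2 p T T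
  Uσ∧p≈Uσ (a ∷ ρ) p = trans' (∧-assoc _ _ _) (∧-congʳ (Uσ∧p≈Uσ ρ p))

  Uσ≈Uσ∧F : ∀ σ → A ⊢ Uσ σ ≈ Uσ σ ∧• F
  Uσ≈Uσ∧F σ = sym' (Uσ∧p≈Uσ σ F)

  ¬Uσ≈Uσ : ∀ σ → A ⊢ ¬' Uσ σ ≈ Uσ σ
  ¬Uσ≈Uσ []      = axiom ax-U1 T T T
  ¬Uσ≈Uσ (a ∷ ρ) = begin
    ¬' (atom a ∧• Uσ ρ)              ≈⟨ cong¬ (cong∧ (axiom ax-nn _ T T) (axiom ax-nn _ T T)) ⟨
    ¬' (¬' ¬' atom a ∧• ¬' ¬' Uσ ρ)  ≈⟨ axiom ax-or (¬' atom a) (¬' Uσ ρ) T ⟨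
    ¬' atom a ∨• ¬' Uσ ρ             ≈⟨ cong∨ refl' (¬Uσ≈Uσ ρ) ⟩
    ¬' atom a ∨• Uσ ρ                ≈⟨ p∨W≈p∧W _ (Uσ≈Uσ∧F ρ) (¬Uσ≈Uσ ρ) ⟩
    ¬' atom a ∧• Uσ ρ                ≈⟨ ¬p∧W≈p∧W _ (Uσ≈Uσ∧F ρ) ⟩
    atom a ∧• Uσ ρ                   ∎

  Uσ∨p≈Uσ : ∀ σ (p : Term A V) → A ⊢ Uσ σ ∨• p ≈ Uσ σ
  Uσ∨p≈Uσ σ p = begin
    Uσ σ ∨• p                 ≈⟨ axiom ax-or (Uσ σ) p T ⟩
    ¬' (¬' Uσ σ ∧• ¬' p)      ≈⟨ cong¬ (∧-congˡ (¬Uσ≈Uσ σ)) ⟩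
    ¬' (Uσ σ ∧• ¬' p)         ≈⟨ cong¬ (Uσ∧p≈Uσ σ _) ⟩
    ¬' Uσ σ                   ≈⟨ ¬Uσ≈Uσ σ ⟩
    Uσ σ                      ∎

  ≈-isUσ : ∀ {P Q : Term A V} → A ⊢ P ≈ Q → IsUσ Q → IsUσ P
  ≈-isUσ P≈Q = map₂ (trans' P≈Q)

  isUσ⇒≈∧F : ∀ {P : Term A V} → IsUσ P → A ⊢ P ≈ P ∧• F
  isUσ⇒≈∧F {P} (σ , P≈Uσ) = begin
    P          ≈⟨ P≈Uσ ⟩
    Uσ σ       ≈⟨ Uσ≈Uσ∧F σ ⟩
    Uσ σ ∧• F  ≈⟨ ∧-congˡ P≈Uσ ⟨
    P ∧• F     ∎

  isUσ⇒¬≈ : ∀ {P : Term A V} → IsUσ P → A ⊢ ¬' P ≈ P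
  isUσ⇒¬≈ {P} (σ , P≈Uσ) = begin
    ¬' P     ≈⟨ cong¬ P≈Uσ ⟩
    ¬' Uσ σ  ≈⟨ ¬Uσ≈Uσ σ ⟩
    Uσ σ     ≈⟨ P≈Uσ ⟨
    P        ∎

  isUσ-¬ : ∀ {P : Term A V} → IsUσ P → IsUσ (¬' P)
  isUσ-¬ isUσP = ≈-isUσ (isUσ⇒¬≈ isUσP) isUσP

  isUσ-∧ˡ : ∀ {P : Term A V} Q → IsUσ P → IsUσ (P ∧• Q)
  isUσ-∧ˡ Q (σ , P≈Uσ) = σ , trans' (∧-congˡ P≈Uσ) (Uσ∧p≈Uσ σ Q)

  isUσ-∨ˡ : ∀ {P : Term A V} Q → IsUσ P → IsUσ (P ∨• Q)
  isUσ-∨ˡ Q (σ , P≈Uσ) = σ , trans' (cong∨ P≈Uσ refl') (Uσ∨p≈Uσ σ Q)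

module _ {A : Set} where
  open SetoidReasoning (⊢-setoid A ⊥)

  isUσ-∧ʳ : ∀ (p : Closed A) {Q} → IsUσ Q → IsUσ (p ∧• Q)
  isUσ-∧ʳ T        {Q} isUσQ      = ≈-isUσ (axiom ax-Tl Q T T) isUσQ
  isUσ-∧ʳ F        {Q} isUσQ      =
    ≈-isUσ (sym' (trans' (isUσ⇒≈∧F isUσQ) (axiom ax-F1 Q T T))) isUσQ
  isUσ-∧ʳ U        {Q} _          = [] , axiom ax-U2 Q T T
  isUσ-∧ʳ (atom a)     (σ , Q≈Uσ) = a ∷ σ , ∧-congʳ Q≈Uσ
  isUσ-∧ʳ (¬' p)       isUσQ      =
    ≈-isUσ (¬p∧W≈p∧W p (isUσ⇒≈∧F isUσQ)) (isUσ-∧ʳ p isUσQ)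
  isUσ-∧ʳ (p ∧• q) {Q} isUσQ      = ≈-isUσ (∧-assoc p q Q) (isUσ-∧ʳ p (isUσ-∧ʳ q isUσQ))
  isUσ-∧ʳ (p ∨• q) {Q} isUσQ      = ≈-isUσ (begin
    (p ∨• q) ∧• Q               ≈⟨ ∧-congˡ (axiom ax-or p q T) ⟩
    ¬' (¬' p ∧• ¬' q) ∧• Q      ≈⟨ ¬p∧W≈p∧W _ (isUσ⇒≈∧F isUσQ) ⟩
    (¬' p ∧• ¬' q) ∧• Q         ≈⟨ ∧-assoc _ _ _ ⟩
    ¬' p ∧• (¬' q ∧• Q)         ≈⟨ ∧-congʳ (¬p∧W≈p∧W q (isUσ⇒≈∧F isUσQ)) ⟩
    ¬' p ∧• (q ∧• Q)            ≈⟨ ¬p∧W≈p∧W p (isUσ⇒≈∧F isUσq∧Q) ⟩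
    p ∧• (q ∧• Q)               ∎) (isUσ-∧ʳ p isUσq∧Q)
    where
    isUσq∧Q : IsUσ (q ∧• Q)
    isUσq∧Q = isUσ-∧ʳ q isUσQ

  isUσ-∨ʳ : ∀ (p : Closed A) {Q} → IsUσ Q → IsUσ (p ∨• Q)
  isUσ-∨ʳ p isUσQ = ≈-isUσ (p∨W≈p∧W p (isUσ⇒≈∧F isUσQ) (isUσ⇒¬≈ isUσQ)) (isUσ-∧ʳ p isUσQ)

  containsU⇒isUσ : (P : Closed A) → ContainsU P → IsUσ P
  containsU⇒isUσ U        here     = [] , refl'
  containsU⇒isUσ (¬' p)   (in¬ c)  = isUσ-¬ (containsU⇒isUσ p c)
  containsU⇒isUσ (p ∧• q) (in∧l c) = isUσ-∧ˡ q (containsU⇒isUσ p c)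
  containsU⇒isUσ (p ∧• q) (in∧r c) = isUσ-∧ʳ p (containsU⇒isUσ q c)
  containsU⇒isUσ (p ∨• q) (in∨l c) = isUσ-∨ˡ q (containsU⇒isUσ p c)
  containsU⇒isUσ (p ∨• q) (in∨r c) = isUσ-∨ʳ p (containsU⇒isUσ q c)

lemma3p12 : {A : Set} → Countable A → (P : Closed A) → ContainsU P →
    ∃ λ (σ : List A) → A ⊢ P ≈ Uσ σ
lemma3p12 _ = containsU⇒isUσ
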